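{- Let $t$ be a positive integer, let $U$ be a finite set and let $A_1,\dots,A_t,B\subseteq U$. For an integer $r\ge 1$ let $$H_r:=\bigcup_{\substack{I\subseteq[t]\\|I|\ge r}}\Big(\bigcap_{i\in I}A_i\cap\bigcap_{j\in[t]\setminus I}(U\setminus A_j)\Big)=\{x\in U:\ |\{i\in[t]: x\in A_i\}|\ge r\}.$$ Let $\hat r\in\{1,\dots,t\}$ be such that $|H_{\hat r}|\le |B|$. Then $$\min_{i\in[t]}|A_i\cap B|\le \frac1t\Big(\sum_{r=\hat r}^{t}|H_r|+(\hat r-1)|B|\Big).$$
   Context: $[t]=\{1,\dots,t\}$. -}

module Defs where

open import Data.Nat using (ℕ; zero; suc; _+_; _*_; _∸_; _≤_; _≤ᵇ_; _⊓_)
open import Data.Fin using (Fin; zero; suc; toℕ)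
open import Data.Fin.Subset using (Subset; ∣_∣; _∩_; inside; outside)
open import Data.Vec using (Vec; tabulate; lookup)
open import Data.Bool using (if_then_else_)

-- The ground set U is modelled as Fin n; subsets of U as Subset n.

memberIndices : ∀ {t n} → (Fin t → Subset n) → Fin n → Subset t
memberIndices A x = tabulate (λ i → lookup (A i) x)

H : ∀ {t n} → (Fin t → Subset n) → ℕ → Subset n
H A r = tabulate (λ x → if r ≤ᵇ ∣ memberIndices A x ∣ then inside else outside)

minFin : ∀ {k} → (Fin (suc k) → ℕ) → ℕ
minFin {zero}  f = f zero
minFin {suc k} f = f zero ⊓ minFin {k} (λ i → f (suc i))

sumFromTo : ℕ → ℕ → (ℕ → ℕ) → ℕ
sumFromTo a zero    f = if a ≤ᵇ 0 then f 0 else 0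
sumFromTo a (suc b) f = sumFromTo a b f + (if a ≤ᵇ suc b then f (suc b) else 0)

-- Double counting: Σᵢ |Aᵢ ∩ B| = Σ_{x ∈ B} d(x), where d(x) = |{i : x ∈ Aᵢ}| ≤ t is the
-- degree of x, and the left-hand side is at least t · minᵢ |Aᵢ ∩ B|.  Pointwise,
-- d ≤ (r̂ − 1) + |{r : r̂ ≤ r ≤ t, r ≤ d}|, and summing the last term over all x gives
-- Σ_{r = r̂}^{t} |H_r|.
module Submission where

open import Defs
open import Data.Nat using (ℕ; zero; suc; _+_; _*_; _∸_; _≤_; _≤ᵇ_; _⊓_; z≤n; s≤s)
open import Data.Nat.Properties
open import Data.Fin using (Fin; zero; suc)
open import Data.Fin.Subset using (Subset; ∣_∣; _∩_)
open import Data.Fin.Subset.Properties using (∣p∣≤n)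
open import Data.Bool using (Bool; true; false; if_then_else_; _∧_)
open import Data.Bool.Properties using (if-float)
open import Data.Vec using ([]; _∷_; lookup)
open import Data.Vec.Properties using (lookup-zipWith; lookup∘tabulate)
open import Relation.Nullary.Reflects using (ofʸ; ofⁿ)
open import Relation.Binary.PropositionalEquality using (_≡_; refl; sym; trans; cong; cong₂; module ≡-Reasoning)
open import Algebra.Properties.Semiring.Sum +-*-semiring
  using (sum; sum-syntax; sum-cong-≗; sum-replicate-zero; ∑-comm; ∑-distrib-+; *-distribˡ-sum)

𝟙 : Bool → ℕ
𝟙 b = if b then 1 else 0

𝟙-∧ : ∀ a b → 𝟙 (a ∧ b) ≡ 𝟙 b * 𝟙 a
𝟙-∧ true  b = sym (*-identityʳ (𝟙 b))
𝟙-∧ false b = sym (*-zeroʳ (𝟙 b))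

∣p∣≡∑𝟙 : ∀ {n} (p : Subset n) → ∣ p ∣ ≡ ∑[ x < n ] 𝟙 (lookup p x)
∣p∣≡∑𝟙 []          = refl
∣p∣≡∑𝟙 (true  ∷ p) = cong suc (∣p∣≡∑𝟙 p)
∣p∣≡∑𝟙 (false ∷ p) = ∣p∣≡∑𝟙 p

∑-mono-≤ : ∀ {n} {f g : Fin n → ℕ} → (∀ x → f x ≤ g x) → sum f ≤ sum g
∑-mono-≤ {zero}  f≤g = z≤n
∑-mono-≤ {suc n} f≤g = +-mono-≤ (f≤g zero) (∑-mono-≤ (λ x → f≤g (suc x)))

*-minFin≤∑ : ∀ {k} (f : Fin (suc k) → ℕ) → suc k * minFin f ≤ sum f
*-minFin≤∑ {zero}  f = ≤-refl
*-minFin≤∑ {suc k} f = +-mono-≤ (m⊓n≤m (f zero) _)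
  (≤-trans (*-monoʳ-≤ (suc k) (m⊓n≤n (f zero) _)) (*-minFin≤∑ (λ i → f (suc i))))

sumFromTo-cong : ∀ a m {f g : ℕ → ℕ} → (∀ r → f r ≡ g r) → sumFromTo a m f ≡ sumFromTo a m g
sumFromTo-cong a zero    f≡g = cong (λ h → if a ≤ᵇ 0 then h else 0) (f≡g 0)
sumFromTo-cong a (suc m) f≡g =
  cong₂ _+_ (sumFromTo-cong a m f≡g) (cong (λ h → if a ≤ᵇ suc m then h else 0) (f≡g (suc m)))

sumFromTo-∑ : ∀ {n} a m (g : ℕ → Fin n → ℕ) →
  ∑[ x < n ] sumFromTo a m (λ r → g r x) ≡ sumFromTo a m (λ r → ∑[ x < n ] g r x)
sumFromTo-∑ {n} a zero g with a ≤ᵇ 0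
... | true  = refl
... | false = sum-replicate-zero n
sumFromTo-∑ {n} a (suc m) g with a ≤ᵇ suc m
... | true  = trans (∑-distrib-+ (λ x → sumFromTo a m (λ r → g r x)) (g (suc m)))
  (cong (_+ sum (g (suc m))) (sumFromTo-∑ a m g))
... | false = trans (∑-distrib-+ (λ x → sumFromTo a m (λ r → g r x)) (λ _ → 0))
  (cong₂ _+_ (sumFromTo-∑ a m g) (sum-replicate-zero n))

m⊓c≤sumFromTo-𝟙≤+a∸1 : ∀ a c m → m ⊓ c ≤ sumFromTo a m (λ r → 𝟙 (r ≤ᵇ c)) + (a ∸ 1)
m⊓c≤sumFromTo-𝟙≤+a∸1 a c zero = z≤n
m⊓c≤sumFromTo-𝟙≤+a∸1 a c (suc m)
  with suc m ≤ᵇ c | ≤ᵇ-reflects-≤ (suc m) c | a ≤ᵇ suc m | ≤ᵇ-reflects-≤ a (suc m)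
... | false | ofⁿ 1+m≰c | _ | _ = begin
  suc m ⊓ c ≡⟨ m≥n⇒m⊓n≡n (m≤n⇒m≤1+n c≤m) ⟩
  c         ≡⟨ m≥n⇒m⊓n≡n c≤m ⟨
  m ⊓ c     ≤⟨ m⊓c≤sumFromTo-𝟙≤+a∸1 a c m ⟩
  S + d     ≤⟨ +-monoˡ-≤ d (m≤m+n S _) ⟩
  _         ∎
  where
  open ≤-Reasoning
  S = sumFromTo a m (λ r → 𝟙 (r ≤ᵇ c))
  d = a ∸ 1
  c≤m : c ≤ m
  c≤m = ≤-pred (≰⇒> 1+m≰c)
... | true | ofʸ m<c | true | ofʸ _ = begin
  suc m ⊓ c     ≡⟨ m≤n⇒m⊓n≡m m<c ⟩
  suc m         ≡⟨ cong suc (m≤n⇒m⊓n≡m (<⇒≤ m<c)) ⟨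
  suc (m ⊓ c)   ≤⟨ s≤s (m⊓c≤sumFromTo-𝟙≤+a∸1 a c m) ⟩
  suc (S + d)   ≡⟨ cong (_+ d) (+-comm 1 S) ⟩
  S + 1 + d     ∎
  where
  open ≤-Reasoning
  S = sumFromTo a m (λ r → 𝟙 (r ≤ᵇ c))
  d = a ∸ 1
... | true | ofʸ m<c | false | ofⁿ a≰1+m = begin
  suc m ⊓ c ≡⟨ m≤n⇒m⊓n≡m m<c ⟩
  suc m     ≤⟨ ∸-monoˡ-≤ 1 (≰⇒> a≰1+m) ⟩
  a ∸ 1     ≤⟨ m≤n+m (a ∸ 1) _ ⟩
  _         ∎
  where open ≤-Reasoning

𝟙*c≤sumFromTo-𝟙≤+a∸1*𝟙 : ∀ a b {c m} → c ≤ m →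
  𝟙 b * c ≤ sumFromTo a m (λ r → 𝟙 (r ≤ᵇ c)) + (a ∸ 1) * 𝟙 b
𝟙*c≤sumFromTo-𝟙≤+a∸1*𝟙 a false c≤m = z≤n
𝟙*c≤sumFromTo-𝟙≤+a∸1*𝟙 a true {c} {m} c≤m = begin
  1 * c         ≡⟨ *-identityˡ c ⟩
  c             ≡⟨ m≥n⇒m⊓n≡n c≤m ⟨
  m ⊓ c         ≤⟨ m⊓c≤sumFromTo-𝟙≤+a∸1 a c m ⟩
  S + (a ∸ 1)   ≡⟨ cong (S +_) (*-identityʳ (a ∸ 1)) ⟨
  S + (a ∸ 1) * 1 ∎
  where
  open ≤-Reasoning
  S = sumFromTo a m (λ r → 𝟙 (r ≤ᵇ c))

module _ {t n} (A : Fin t → Subset n) where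

  degree : Fin n → ℕ
  degree x = ∣ memberIndices A x ∣

  degree≡∑𝟙 : ∀ x → degree x ≡ ∑[ i < t ] 𝟙 (lookup (A i) x)
  degree≡∑𝟙 x = trans (∣p∣≡∑𝟙 (memberIndices A x))
    (sum-cong-≗ (λ i → cong 𝟙 (lookup∘tabulate (λ j → lookup (A j) x) i)))

  ∑∣Aᵢ∩B∣≡∑𝟙*degree : ∀ B → ∑[ i < t ] ∣ A i ∩ B ∣ ≡ ∑[ x < n ] (𝟙 (lookup B x) * degree x)
  ∑∣Aᵢ∩B∣≡∑𝟙*degree B = begin
    ∑[ i < t ] ∣ A i ∩ B ∣
      ≡⟨ sum-cong-≗ (λ i → ∣p∣≡∑𝟙 (A i ∩ B)) ⟩
    ∑[ i < t ] ∑[ x < n ] 𝟙 (lookup (A i ∩ B) x)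
      ≡⟨ sum-cong-≗ (λ i → sum-cong-≗ (𝟙-∩ i)) ⟩
    ∑[ i < t ] ∑[ x < n ] (𝟙 (lookup B x) * 𝟙 (lookup (A i) x))
      ≡⟨ ∑-comm (λ i x → 𝟙 (lookup B x) * 𝟙 (lookup (A i) x)) ⟩
    ∑[ x < n ] ∑[ i < t ] (𝟙 (lookup B x) * 𝟙 (lookup (A i) x))
      ≡⟨ sum-cong-≗ (λ x → *-distribˡ-sum (𝟙 (lookup B x)) (λ i → 𝟙 (lookup (A i) x))) ⟨
    ∑[ x < n ] (𝟙 (lookup B x) * ∑[ i < t ] 𝟙 (lookup (A i) x))
      ≡⟨ sum-cong-≗ (λ x → cong (𝟙 (lookup B x) *_) (degree≡∑𝟙 x)) ⟨
    ∑[ x < n ] (𝟙 (lookup B x) * degree x)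
      ∎
    where
    open ≡-Reasoning
    𝟙-∩ : ∀ i x → 𝟙 (lookup (A i ∩ B) x) ≡ 𝟙 (lookup B x) * 𝟙 (lookup (A i) x)
    𝟙-∩ i x = trans (cong 𝟙 (lookup-zipWith _∧_ x (A i) B)) (𝟙-∧ (lookup (A i) x) (lookup B x))

  ∣H∣≡∑𝟙≤degree : ∀ r → ∣ H A r ∣ ≡ ∑[ x < n ] 𝟙 (r ≤ᵇ degree x)
  ∣H∣≡∑𝟙≤degree r = trans (∣p∣≡∑𝟙 (H A r)) (sum-cong-≗ λ x →
    trans (cong 𝟙 (lookup∘tabulate (λ y → if r ≤ᵇ degree y then true else false) x))
          (if-float 𝟙 (r ≤ᵇ degree x)))

lemma4p4 : (k n : ℕ) (A : Fin (suc k) → Subset n) (B : Subset n) (r̂ : ℕ) →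
    1 ≤ r̂ → r̂ ≤ suc k → ∣ H A r̂ ∣ ≤ ∣ B ∣ →
    suc k * minFin (λ i → ∣ A i ∩ B ∣)
      ≤ sumFromTo r̂ (suc k) (λ r → ∣ H A r ∣) + (r̂ ∸ 1) * ∣ B ∣
lemma4p4 k n A B r̂ _ _ _ = begin
  suc k * minFin (λ i → ∣ A i ∩ B ∣)           ≤⟨ *-minFin≤∑ (λ i → ∣ A i ∩ B ∣) ⟩
  ∑[ i < suc k ] ∣ A i ∩ B ∣                  ≡⟨ ∑∣Aᵢ∩B∣≡∑𝟙*degree A B ⟩
  ∑[ x < n ] (b x * degree A x)               ≤⟨ ∑-mono-≤ pointwise ⟩
  ∑[ x < n ] (count x + (r̂ ∸ 1) * b x)        ≡⟨ ∑-distrib-+ count (λ x → (r̂ ∸ 1) * b x) ⟩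
  ∑[ x < n ] count x + ∑[ x < n ] ((r̂ ∸ 1) * b x)
    ≡⟨ cong₂ _+_ (sumFromTo-∑ r̂ (suc k) (λ r x → 𝟙 (r ≤ᵇ degree A x))) (sym (*-distribˡ-sum (r̂ ∸ 1) b)) ⟩
  sumFromTo r̂ (suc k) (λ r → ∑[ x < n ] 𝟙 (r ≤ᵇ degree A x)) + (r̂ ∸ 1) * sum b
    ≡⟨ cong₂ _+_ (sumFromTo-cong r̂ (suc k) (∣H∣≡∑𝟙≤degree A)) (cong ((r̂ ∸ 1) *_) (∣p∣≡∑𝟙 B)) ⟨
  sumFromTo r̂ (suc k) (λ r → ∣ H A r ∣) + (r̂ ∸ 1) * ∣ B ∣ ∎
  where
  open ≤-Reasoning
  b : Fin n → ℕ
  b x = 𝟙 (lookup B x)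
  count : Fin n → ℕ
  count x = sumFromTo r̂ (suc k) (λ r → 𝟙 (r ≤ᵇ degree A x))
  pointwise : ∀ x → b x * degree A x ≤ count x + (r̂ ∸ 1) * b x
  pointwise x = 𝟙*c≤sumFromTo-𝟙≤+a∸1*𝟙 r̂ (lookup B x) (∣p∣≤n (memberIndices A x))
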